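{- For every $n\geqslant 2$, $$D(F_n\star K_1)=\Big\lceil \sqrt{\tfrac{1+\sqrt{8n+1}}{2}}\,\Big\rceil.$$
   Context: All graphs are finite and simple. The friendship graph $F_n$ ($n\geqslant 2$) is obtained by joining $n$ copies of the cycle $C_3$ at a common vertex. For a graph $G$, $G\star K_1$ is the graph obtained from $G$ by adding, for each vertex $v$ of $G$, a new vertex $K_1^{v}$ adjacent exactly to the neighbours of $v$ in $G$ (the neighbourhood corona of $G$ with $K_1$). The distinguishing number $D(G)$ is the least $r$ such that there is a labeling $V(G)\to\{1,\dots,r\}$ preserved by no non-identity automorphism of $G$. -}

module Defs where

open import Data.Nat using (ℕ; zero; suc; _+_; _*_; _∸_; _≤_; _<_)
open import Data.Fin using (Fin)
open import Data.Product using (Σ; ∃; _×_; _,_)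
open import Data.Sum using (_⊎_; inj₁; inj₂)
open import Data.Maybe using (Maybe; just; nothing)
open import Data.Empty using (⊥)
open import Data.Unit using (⊤)
open import Relation.Nullary using (¬_)
open import Relation.Binary.PropositionalEquality using (_≡_; _≢_)
open import Function.Bundles using (_↔_; Inverse; _⇔_)

record Graph : Set₁ where
  field
    V   : Set
    Adj : V → V → Set
open Graph public

record Aut (G : Graph) : Set where
  field
    perm     : V G ↔ V G
    preserve : ∀ u v → Adj G u v ⇔ Adj G (Inverse.to perm u) (Inverse.to perm v)
open Aut public

apply : {G : Graph} → Aut G → V G → V G
apply σ = Inverse.to (perm σ)

IsDistinguishingLabeling : (G : Graph) (r : ℕ) → (V G → Fin r) → Set
IsDistinguishingLabeling G r ℓ =
  (σ : Aut G) → (∀ v → ℓ (apply σ v) ≡ ℓ v) → ∀ v → apply σ v ≡ v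

HasDistinguishingLabeling : Graph → ℕ → Set
HasDistinguishingLabeling G r = Σ (V G → Fin r) (IsDistinguishingLabeling G r)

DistinguishingNumberIs : Graph → ℕ → Set
DistinguishingNumberIs G d =
  HasDistinguishingLabeling G d × (∀ r → r < d → ¬ HasDistinguishingLabeling G r)

-- Friendship graph F_n: centre = nothing, the n triangles are indexed by
-- Fin n, the two non-central vertices of triangle i are just (i , 0/1).
FriendshipAdj : (n : ℕ) → Maybe (Fin n × Fin 2) → Maybe (Fin n × Fin 2) → Set
FriendshipAdj n nothing nothing = ⊥
FriendshipAdj n nothing (just _) = ⊤
FriendshipAdj n (just _) nothing = ⊤
FriendshipAdj n (just (i , a)) (just (j , b)) = (i ≡ j) × (a ≢ b)

Friendship : ℕ → Graph
Friendship n = record { V = Maybe (Fin n × Fin 2) ; Adj = FriendshipAdj n }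

-- Neighbourhood corona G ⋆ K₁: inj₁ v are the original vertices, inj₂ v is the
-- new vertex K₁^v, adjacent exactly to the neighbours of v in G.
CoronaAdj : (G : Graph) → V G ⊎ V G → V G ⊎ V G → Set
CoronaAdj G (inj₁ u) (inj₁ v) = Adj G u v
CoronaAdj G (inj₁ u) (inj₂ v) = Adj G u v
CoronaAdj G (inj₂ u) (inj₁ v) = Adj G u v
CoronaAdj G (inj₂ u) (inj₂ v) = ⊥

_⋆K₁ : Graph → Graph
G ⋆K₁ = record { V = V G ⊎ V G ; Adj = CoronaAdj G }

-- k = ⌈ sqrt((1 + sqrt(8n+1))/2) ⌉, characterised without reals:
-- for k ≥ 1,  sqrt((1+sqrt(8n+1))/2) ≤ k  ⟺  sqrt(8n+1) ≤ 2k²-1  ⟺  8n+1 ≤ (2k²-1)²,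
-- and for k = 0 both sides are false (2·0²∸1 = 0).
CeilBound : ℕ → ℕ → Set
CeilBound n k = 8 * n + 1 ≤ (2 * (k * k) ∸ 1) * (2 * (k * k) ∸ 1)

IsCeilNestedSqrt : ℕ → ℕ → Set
IsCeilNestedSqrt n k = CeilBound n k × (∀ j → j < k → ¬ CeilBound n j)

module Submission where

-- Every automorphism of F_n ⋆ K₁ with n ≥ 2 fixes the hub (the only vertex with at most one
-- non-neighbour besides itself), hence also its copy hub′, and maps leaves to leaves. So it permutes
-- the n triangles, possibly exchanging the two sides of a triangle, a side being a leaf together
-- with its copy; conversely every such map is an automorphism. A labeling with r colours is therefore
-- distinguishing iff the colour pairs of the two sides of each triangle form n distinct 2-element
-- subsets of [r]², which is possible iff n ≤ C(r², 2). Finally 8·C(m, 2) + 1 = (2m − 1)², so the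
-- least such r is ⌈√((1 + √(8n + 1))/2)⌉.

open import Defs
open import Data.Nat
  using (ℕ; zero; suc; _+_; _*_; _∸_; _≤_; _<_; z≤n; s≤s; s≤s⁻¹; _≤′_; ≤′-refl; ≤′-step)
open import Data.Nat.Properties hiding (_≟_)
open import Data.Nat.Combinatorics using (_C_; nC1≡n; nCk+nC[k+1]≡[n+1]C[k+1])
open import Data.Nat.Tactic.RingSolver using (solve-∀)
open import Data.Fin using (Fin; zero; suc; toℕ; fromℕ<; opposite; _≟_)
open import Data.Fin.Properties
  using (toℕ-injective; fromℕ<-injective; toℕ<n; injective⇒≤; opposite-involutive; *↔×)
open import Function.Definitions using (Injective)
open import Data.Product using (Σ; ∃; ∃₂; _×_; _,_; proj₁; proj₂)
open import Data.Sum using (_⊎_; inj₁; inj₂; [_,_]′)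
open import Data.Empty using (⊥; ⊥-elim)
open import Function using (_∘_)
open import Function.Bundles using (_⇔_; mk⇔; _↔_; Inverse; Injection; Equivalence; mk↔ₛ′)
open import Function.Properties.Inverse using (↔⇒↣)
open import Function.Construct.Identity using (⇔-id)
open import Function.Construct.Symmetry using (↔-sym)
open import Data.Sum.Function.Propositional using (_⊎-↔_)
open import Data.Maybe using (Maybe; just; nothing)
open import Data.Unit using (⊤; tt)
open import Data.Fin.Permutation using (Permutation′; _⟨$⟩ʳ_; _⟨$⟩ˡ_; inverseˡ; inverseʳ; transpose)
open import Data.Bool using (if_then_else_; _∨_)
open import Relation.Nullary using (¬_; Dec; yes; no; does; contradiction)
open import Relation.Unary using (Decidable)
open import Relation.Binary using (tri<; tri≈; tri>)
open import Relation.Binary.PropositionalEquality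

C2-suc : ∀ m → suc m C 2 ≡ m C 2 + m
C2-suc m = begin
  suc m C 2          ≡⟨ nCk+nC[k+1]≡[n+1]C[k+1] m 1 ⟨
  m C 1 + m C 2      ≡⟨ cong (_+ m C 2) (nC1≡n m) ⟩
  m + m C 2          ≡⟨ +-comm m (m C 2) ⟩
  m C 2 + m          ∎
  where open ≡-Reasoning

C2-≤-suc : ∀ m → m C 2 ≤ suc m C 2
C2-≤-suc m = ≤-trans (m≤m+n (m C 2) m) (≤-reflexive (sym (C2-suc m)))

C2-mono-≤ : ∀ {m m′} → m ≤ m′ → m C 2 ≤ m′ C 2
C2-mono-≤ m≤m′ = go (≤⇒≤′ m≤m′)
  where
  go : ∀ {m m′} → m ≤′ m′ → m C 2 ≤ m′ C 2
  go ≤′-refl                 = ≤-refl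
  go (≤′-step {m′} m≤′m′) = ≤-trans (go m≤′m′) (C2-≤-suc m′)

8*C2+1≡odd² : ∀ m → 8 * (suc m C 2) + 1 ≡ suc (2 * m) * suc (2 * m)
8*C2+1≡odd² zero    = refl
8*C2+1≡odd² (suc m) = begin
  8 * (suc (suc m) C 2) + 1               ≡⟨ cong (λ t → 8 * t + 1) (C2-suc (suc m)) ⟩
  8 * (suc m C 2 + suc m) + 1             ≡⟨ regroup (suc m C 2) m ⟩
  (8 * (suc m C 2) + 1) + 8 * suc m       ≡⟨ cong (_+ 8 * suc m) (8*C2+1≡odd² m) ⟩
  suc (2 * m) * suc (2 * m) + 8 * suc m   ≡⟨ next-odd² m ⟩
  suc (2 * suc m) * suc (2 * suc m)       ∎
  where
  open ≡-Reasoning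
  regroup : ∀ t m → 8 * (t + suc m) + 1 ≡ (8 * t + 1) + 8 * suc m
  regroup = solve-∀
  next-odd² : ∀ m → suc (2 * m) * suc (2 * m) + 8 * suc m ≡ suc (2 * suc m) * suc (2 * suc m)
  next-odd² = solve-∀

2*suc∸1 : ∀ m → 2 * suc m ∸ 1 ≡ suc (2 * m)
2*suc∸1 m = cong (_∸ 1) (*-suc 2 m)

square-bound⇔C2 : ∀ {n} m → 1 ≤ n → 8 * n + 1 ≤ (2 * m ∸ 1) * (2 * m ∸ 1) ⇔ n ≤ m C 2
square-bound⇔C2 {n} zero    1≤n = mk⇔
  (λ 8n+1≤0 → contradiction (m+n≤o⇒n≤o (8 * n) 8n+1≤0) λ ())
  (λ n≤0 → contradiction (≤-trans 1≤n n≤0) λ ())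
square-bound⇔C2 {n} (suc m) _ rewrite 2*suc∸1 m | sym (8*C2+1≡odd² m) = mk⇔
  (λ le → *-cancelˡ-≤ 8 (+-cancelʳ-≤ 1 _ _ le))
  (λ le → +-monoˡ-≤ 1 (*-monoʳ-≤ 8 le))

ceilBound⇔ : ∀ {n} k → 1 ≤ n → CeilBound n k ⇔ n ≤ (k * k) C 2
ceilBound⇔ k = square-bound⇔C2 (k * k)

ceilBound? : ∀ n k → Dec (CeilBound n k)
ceilBound? n k = 8 * n + 1 ≤? (2 * (k * k) ∸ 1) * (2 * (k * k) ∸ 1)

n≤[n*n]C2 : ∀ {n} → 2 ≤ n → n ≤ (n * n) C 2
n≤[n*n]C2 {n} 2≤n = begin
  n              ≤⟨ m≤n+m n (n C 2) ⟩
  n C 2 + n      ≡⟨ C2-suc n ⟨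
  suc n C 2      ≤⟨ C2-mono-≤ suc-n≤n*n ⟩
  (n * n) C 2    ∎
  where
  open ≤-Reasoning
  suc-n≤n*n : suc n ≤ n * n
  suc-n≤n*n = begin
    suc n    ≡⟨ +-comm 1 n ⟩
    n + 1    ≤⟨ +-monoʳ-≤ n (≤-trans (s≤s z≤n) 2≤n) ⟩
    n + n    ≡⟨ trans (*-comm n 2) (cong (n +_) (+-identityʳ n)) ⟨
    n * 2    ≤⟨ *-monoʳ-≤ n 2≤n ⟩
    n * n    ∎

module _ {p} {P : ℕ → Set p} (P? : Decidable P) where

  private
    search : ∀ b → (∀ j → j < b → ¬ P j) ⊎ ∃ λ k → P k × (∀ j → j < k → ¬ P j)
    search zero = inj₁ λ _ ()
    search (suc b) with search b | P? b
    ... | inj₂ least | _      = inj₂ least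
    ... | inj₁ none  | yes Pb = inj₂ (b , Pb , none)
    ... | inj₁ none  | no ¬Pb = inj₁ λ j j<1+b →
      [ none j , (λ { refl → ¬Pb }) ]′ (m≤n⇒m<n∨m≡n (s≤s⁻¹ j<1+b))

  least-witness : ∀ {m} → P m → ∃ λ k → P k × (∀ j → j < k → ¬ P j)
  least-witness {m} Pm with search (suc m)
  ... | inj₂ least = least
  ... | inj₁ none  = contradiction Pm (none m ≤-refl)

-- The colex rank of the 2-subset {x < y} of ℕ.
pairIndex : ℕ → ℕ → ℕ
pairIndex x y = y C 2 + x

pairIndex-< : ∀ {x y m} → x < y → y < m → pairIndex x y < m C 2
pairIndex-< {x} {y} {m} x<y y<m = begin-strict
  y C 2 + x    <⟨ +-monoʳ-< (y C 2) x<y ⟩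
  y C 2 + y    ≡⟨ C2-suc y ⟨
  suc y C 2    ≤⟨ C2-mono-≤ y<m ⟩
  m C 2        ∎
  where open ≤-Reasoning

pairIndex-injective : ∀ {x y x′ y′} → x < y → x′ < y′ →
                      pairIndex x y ≡ pairIndex x′ y′ → x ≡ x′ × y ≡ y′
pairIndex-injective {x} {y} {x′} {y′} x<y x′<y′ eq with <-cmp y y′
... | tri≈ _ refl _ = +-cancelˡ-≡ (y C 2) x x′ eq , refl
... | tri< y<y′ _ _ =
  contradiction eq (<⇒≢ (<-≤-trans (pairIndex-< x<y y<y′) (m≤m+n _ x′)))
... | tri> _ _ y′<y =
  contradiction (sym eq) (<⇒≢ (<-≤-trans (pairIndex-< x′<y′ y′<y) (m≤m+n _ x)))

record PairWithIndex (m i : ℕ) : Set where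
  field
    lo hi  : ℕ
    lo<hi  : lo < hi
    hi<m   : hi < m
    index≡ : pairIndex lo hi ≡ i

pairIndex-surjective : ∀ {i} m → i < m C 2 → PairWithIndex m i
pairIndex-surjective {i} zero    ()
pairIndex-surjective {i} (suc m) i<[1+m]C2 with i <? m C 2
... | yes i<mC2 = record
  { lo = lo ; hi = hi ; lo<hi = lo<hi ; hi<m = m<n⇒m<1+n hi<m ; index≡ = index≡ }
  where open PairWithIndex (pairIndex-surjective m i<mC2)
... | no i≮mC2 = record
  { lo = i ∸ m C 2 ; hi = m ; lo<hi = +-cancelˡ-< (m C 2) _ _ i<mC2+m ; hi<m = ≤-refl
  ; index≡ = m+[n∸m]≡n mC2≤i }
  where
  mC2≤i : m C 2 ≤ i
  mC2≤i = ≮⇒≥ i≮mC2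
  i<mC2+m : m C 2 + (i ∸ m C 2) < m C 2 + m
  i<mC2+m = subst₂ _<_ (sym (m+[n∸m]≡n mC2≤i)) (C2-suc m) i<[1+m]C2

-- The unordered pairs {p i 0, p i 1} are n distinct 2-element subsets of A.
Separated : ∀ {n} {A : Set} → (Fin n → Fin 2 → A) → Set
Separated p =
  ∀ i a j b → p i a ≡ p j b → p i (opposite a) ≡ p j (opposite b) → i ≡ j × a ≡ b

module _ {n} {A : Set} {p : Fin n → Fin 2 → A} where

  separated-∘ : ∀ {B : Set} {f : A → B} → Injective _≡_ _≡_ f →
                Separated p → Separated (λ i a → f (p i a))
  separated-∘ f-inj sep i a j b e e′ = sep i a j b (f-inj e) (f-inj e′)

  separated⇒distinct : Separated p → ∀ i → p i zero ≢ p i (suc zero)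
  separated⇒distinct sep i e with () ← proj₂ (sep i zero i (suc zero) e (sym e))

separated⇒≤C2 : ∀ {n m} {p : Fin n → Fin 2 → Fin m} → Separated p → n ≤ m C 2
separated⇒≤C2 {n} {m} {p} sep = injective⇒≤ index-injective
  where
  lower : ∀ i → ∃ λ a → toℕ (p i a) < toℕ (p i (opposite a))
  lower i with <-cmp (toℕ (p i zero)) (toℕ (p i (suc zero)))
  ... | tri< lt _ _ = zero , lt
  ... | tri≈ _ eq _ = contradiction (toℕ-injective eq) (separated⇒distinct sep i)
  ... | tri> _ _ gt = suc zero , gt

  lo hi : Fin n → ℕ
  lo i = toℕ (p i (proj₁ (lower i)))
  hi i = toℕ (p i (opposite (proj₁ (lower i))))

  index : Fin n → Fin (m C 2)
  index i = fromℕ< (pairIndex-< (proj₂ (lower i)) (toℕ<n (p i (opposite (proj₁ (lower i))))))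

  index-injective : Injective _≡_ _≡_ index
  index-injective {i} {j} eq =
    proj₁ (sep i _ j _ (toℕ-injective lo≡) (toℕ-injective hi≡))
    where
    pairIndex≡ : pairIndex (lo i) (hi i) ≡ pairIndex (lo j) (hi j)
    pairIndex≡ = fromℕ<-injective _ _ _ _ eq
    lo≡ : lo i ≡ lo j
    lo≡ = proj₁ (pairIndex-injective (proj₂ (lower i)) (proj₂ (lower j)) pairIndex≡)
    hi≡ : hi i ≡ hi j
    hi≡ = proj₂ (pairIndex-injective (proj₂ (lower i)) (proj₂ (lower j)) pairIndex≡)

≤C2⇒separated : ∀ {n m} → n ≤ m C 2 → Σ (Fin n → Fin 2 → Fin m) Separated
≤C2⇒separated {n} {m} n≤mC2 = (λ i a → fromℕ< (coord<m i a)) , separated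
  where
  pair : (i : Fin n) → PairWithIndex m (toℕ i)
  pair i = pairIndex-surjective m (<-≤-trans (toℕ<n i) n≤mC2)
  open PairWithIndex

  coord : Fin n → Fin 2 → ℕ
  coord i zero       = lo (pair i)
  coord i (suc zero) = hi (pair i)

  coord<m : ∀ i a → coord i a < m
  coord<m i zero       = <-trans (lo<hi (pair i)) (hi<m (pair i))
  coord<m i (suc zero) = hi<m (pair i)

  same-pair : ∀ {i j} → lo (pair i) ≡ lo (pair j) → hi (pair i) ≡ hi (pair j) → i ≡ j
  same-pair {i} {j} lo≡ hi≡ =
    toℕ-injective (trans (sym (index≡ (pair i)))
                         (trans (cong₂ pairIndex lo≡ hi≡) (index≡ (pair j))))

  crossed-pair : ∀ {i j} → lo (pair i) ≡ hi (pair j) → hi (pair i) ≡ lo (pair j) → ⊥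
  crossed-pair {i} {j} lo≡hi hi≡lo = <-asym
    (subst (lo (pair i) <_) hi≡lo (lo<hi (pair i)))
    (subst (lo (pair j) <_) (sym lo≡hi) (lo<hi (pair j)))

  coords-separated : ∀ i a j b → coord i a ≡ coord j b →
                     coord i (opposite a) ≡ coord j (opposite b) → i ≡ j × a ≡ b
  coords-separated i zero       j zero       c≡ c≡′ = same-pair c≡ c≡′ , refl
  coords-separated i (suc zero) j (suc zero) c≡ c≡′ = same-pair c≡′ c≡ , refl
  coords-separated i zero       j (suc zero) c≡ c≡′ = ⊥-elim (crossed-pair c≡ c≡′)
  coords-separated i (suc zero) j zero       c≡ c≡′ = ⊥-elim (crossed-pair c≡′ c≡)

  separated : Separated (λ i a → fromℕ< (coord<m i a))
  separated i a j b e e′ = coords-separated i a j b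
    (fromℕ<-injective _ _ (coord<m i a) (coord<m j b) e)
    (fromℕ<-injective _ _ (coord<m i (opposite a)) (coord<m j (opposite b)) e′)

module _ {G : Graph} (σ : Aut G) where

  apply-injective : ∀ {x y} → apply σ x ≡ apply σ y → x ≡ y
  apply-injective = Injection.injective (↔⇒↣ (perm σ))

  apply-from : ∀ y → apply σ (Inverse.from (perm σ) y) ≡ y
  apply-from = Inverse.strictlyInverseˡ (perm σ)

  apply-adj : ∀ {x y} → Adj G x y → Adj G (apply σ x) (apply σ y)
  apply-adj {x} {y} = Equivalence.to (preserve σ x y)

  apply-adj⁻¹ : ∀ {x y} → Adj G (apply σ x) (apply σ y) → Adj G x y
  apply-adj⁻¹ {x} {y} = Equivalence.from (preserve σ x y)

  apply-≢-at : ∀ {u w x} → apply σ u ≡ w → x ≢ u → apply σ x ≢ w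
  apply-≢-at refl x≢u e = x≢u (apply-injective e)

  apply-adj-at : ∀ {u w x} → apply σ u ≡ w → Adj G u x → Adj G w (apply σ x)
  apply-adj-at refl = apply-adj

  apply-nonadj-at : ∀ {u w x} → apply σ u ≡ w → ¬ Adj G u x → ¬ Adj G w (apply σ x)
  apply-nonadj-at refl u≁x a = u≁x (apply-adj⁻¹ a)

AtMostOneNonNeighbour : (G : Graph) → V G → Set
AtMostOneNonNeighbour G v = ∀ {x y} → x ≢ v → y ≢ v → ¬ Adj G v x → ¬ Adj G v y → x ≡ y

atMostOneNonNeighbour-apply : ∀ {G v} (σ : Aut G) →
                              AtMostOneNonNeighbour G v → AtMostOneNonNeighbour G (apply σ v)
atMostOneNonNeighbour-apply {G} {v} σ unique {x} {y} x≢σv y≢σv σv≁x σv≁y = begin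
  x          ≡⟨ apply-from σ x ⟨
  apply σ x′ ≡⟨ cong (apply σ) (unique (pull-≢ x≢σv) (pull-≢ y≢σv) (pull-≁ σv≁x) (pull-≁ σv≁y)) ⟩
  apply σ y′ ≡⟨ apply-from σ y ⟩
  y          ∎
  where
  open ≡-Reasoning
  x′ y′ : V G
  x′ = Inverse.from (perm σ) x
  y′ = Inverse.from (perm σ) y
  pull-≢ : ∀ {z} → z ≢ apply σ v → Inverse.from (perm σ) z ≢ v
  pull-≢ {z} z≢σv e = z≢σv (trans (sym (apply-from σ z)) (cong (apply σ) e))
  pull-≁ : ∀ {z} → ¬ Adj G (apply σ v) z → ¬ Adj G v (Inverse.from (perm σ) z)
  pull-≁ {z} σv≁z a = σv≁z (subst (Adj G (apply σ v)) (apply-from σ z) (apply-adj σ a))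

coronaAut : ∀ {G} → Aut G → Aut (G ⋆K₁)
coronaAut {G} σ = record { perm = perm′ ; preserve = preserve′ }
  where
  perm′ : V (G ⋆K₁) ↔ V (G ⋆K₁)
  perm′ = perm σ ⊎-↔ perm σ
  preserve′ : ∀ u v → Adj (G ⋆K₁) u v ⇔ Adj (G ⋆K₁) (Inverse.to perm′ u) (Inverse.to perm′ v)
  preserve′ (inj₁ u) (inj₁ v) = preserve σ u v
  preserve′ (inj₁ u) (inj₂ v) = preserve σ u v
  preserve′ (inj₂ u) (inj₁ v) = preserve σ u v
  preserve′ (inj₂ u) (inj₂ v) = ⇔-id ⊥

_⊕_ : Fin 2 → Fin 2 → Fin 2
a ⊕ zero     = a
a ⊕ suc zero = opposite a

⊕-involutive : ∀ a t → (a ⊕ t) ⊕ t ≡ a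
⊕-involutive a zero       = refl
⊕-involutive a (suc zero) = opposite-involutive a

⊕-injectiveˡ : ∀ {a b} t → a ⊕ t ≡ b ⊕ t → a ≡ b
⊕-injectiveˡ {a} {b} t e =
  trans (sym (⊕-involutive a t)) (trans (cong (_⊕ t) e) (⊕-involutive b t))

⊕-cancelˡ : ∀ a b → a ⊕ (a ⊕ b) ≡ b
⊕-cancelˡ zero       zero       = refl
⊕-cancelˡ zero       (suc zero) = refl
⊕-cancelˡ (suc zero) zero       = refl
⊕-cancelˡ (suc zero) (suc zero) = refl

opposite-≢ : ∀ (a : Fin 2) → a ≢ opposite a
opposite-≢ zero       ()
opposite-≢ (suc zero) ()

≢⇒opposite : ∀ {a b : Fin 2} → a ≢ b → b ≡ opposite a
≢⇒opposite {zero}     {zero}     a≢b = contradiction refl a≢b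
≢⇒opposite {zero}     {suc zero} _   = refl
≢⇒opposite {suc zero} {zero}     _   = refl
≢⇒opposite {suc zero} {suc zero} a≢b = contradiction refl a≢b

agree⇒⊕-shift : ∀ {A : Set} {p q : Fin 2 → A} {a b} →
                p a ≡ q b → p (opposite a) ≡ q (opposite b) → ∀ x → p x ≡ q (x ⊕ (a ⊕ b))
agree⇒⊕-shift {a = zero}     {zero}     e e′ zero       = e
agree⇒⊕-shift {a = zero}     {zero}     e e′ (suc zero) = e′
agree⇒⊕-shift {a = zero}     {suc zero} e e′ zero       = e
agree⇒⊕-shift {a = zero}     {suc zero} e e′ (suc zero) = e′
agree⇒⊕-shift {a = suc zero} {zero}     e e′ zero       = e′
agree⇒⊕-shift {a = suc zero} {zero}     e e′ (suc zero) = e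
agree⇒⊕-shift {a = suc zero} {suc zero} e e′ zero       = e′
agree⇒⊕-shift {a = suc zero} {suc zero} e e′ (suc zero) = e

blockAut : ∀ {n} → Permutation′ n → (Fin n → Fin 2) → Aut (Friendship n)
blockAut {n} π τ = record { perm = mk↔ₛ′ to from to∘from from∘to ; preserve = preserve′ }
  where
  to from : Maybe (Fin n × Fin 2) → Maybe (Fin n × Fin 2)
  to nothing        = nothing
  to (just (k , a)) = just (π ⟨$⟩ʳ k , a ⊕ τ k)
  from nothing        = nothing
  from (just (k , a)) = just (π ⟨$⟩ˡ k , a ⊕ τ (π ⟨$⟩ˡ k))

  to∘from : ∀ v → to (from v) ≡ v
  to∘from nothing        = refl
  to∘from (just (k , a)) =
    cong₂ (λ l b → just (l , b)) (inverseʳ π) (⊕-involutive a (τ (π ⟨$⟩ˡ k)))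

  from∘to : ∀ v → from (to v) ≡ v
  from∘to nothing        = refl
  from∘to (just (k , a)) = cong₂ (λ l b → just (l , b)) (inverseˡ π)
    (trans (cong ((a ⊕ τ k) ⊕_) (cong τ (inverseˡ π))) (⊕-involutive a (τ k)))

  same-triangle : ∀ {k l a b} → k ≡ l × a ≢ b →
                  π ⟨$⟩ʳ k ≡ π ⟨$⟩ʳ l × a ⊕ τ k ≢ b ⊕ τ l
  same-triangle {k} (refl , a≢b) = refl , λ e → a≢b (⊕-injectiveˡ (τ k) e)

  same-triangle⁻¹ : ∀ {k l a b} → π ⟨$⟩ʳ k ≡ π ⟨$⟩ʳ l × a ⊕ τ k ≢ b ⊕ τ l →
                    k ≡ l × a ≢ b
  same-triangle⁻¹ {k} (πk≡πl , ne) with refl ← Injection.injective (↔⇒↣ π) πk≡πl =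
    refl , λ a≡b → ne (cong (_⊕ τ k) a≡b)

  preserve′ : ∀ u v → FriendshipAdj n u v ⇔ FriendshipAdj n (to u) (to v)
  preserve′ nothing  nothing  = ⇔-id ⊥
  preserve′ nothing  (just _) = ⇔-id ⊤
  preserve′ (just _) nothing  = ⇔-id ⊤
  preserve′ (just _) (just _) = mk⇔ same-triangle same-triangle⁻¹

F⋆K₁ : ℕ → Graph
F⋆K₁ n = Friendship n ⋆K₁

pattern hub        = inj₁ nothing
pattern hub′       = inj₂ nothing
pattern leaf  i a  = inj₁ (just (i , a))
pattern leaf′ i a  = inj₂ (just (i , a))

leaf-injective : ∀ {n} {i j : Fin n} {a b} →
                 _≡_ {A = V (F⋆K₁ n)} (leaf i a) (leaf j b) → i ≡ j × a ≡ b
leaf-injective refl = refl , refl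

sideLabel : ∀ {n r} → (V (F⋆K₁ n) → Fin r) → Fin n → Fin 2 → Fin r × Fin r
sideLabel ℓ i a = ℓ (leaf i a) , ℓ (leaf′ i a)

-- The hub labels are irrelevant, since every automorphism fixes hub and hub′.
sideLabelling : ∀ {n r} → Fin r → (Fin n → Fin 2 → Fin r × Fin r) → V (F⋆K₁ n) → Fin r
sideLabelling c q hub         = c
sideLabelling c q hub′        = c
sideLabelling c q (leaf i a)  = proj₁ (q i a)
sideLabelling c q (leaf′ i a) = proj₂ (q i a)

another : ∀ {n} → 2 ≤ n → (i : Fin n) → ∃ λ j → j ≢ i
another (s≤s (s≤s _)) zero    = suc zero , λ ()
another (s≤s (s≤s _)) (suc _) = zero , λ ()

module _ {n : ℕ} where

  private
    G : Graph
    G = F⋆K₁ n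

  non-neighbour-of-hub : ∀ {x} → x ≢ hub → ¬ Adj G hub x → x ≡ hub′
  non-neighbour-of-hub {hub}       x≢hub _   = contradiction refl x≢hub
  non-neighbour-of-hub {hub′}      _     _   = refl
  non-neighbour-of-hub {leaf _ _}  _     hub≁x = contradiction tt hub≁x
  non-neighbour-of-hub {leaf′ _ _} _     hub≁x = contradiction tt hub≁x

  hub-atMostOneNonNeighbour : AtMostOneNonNeighbour G hub
  hub-atMostOneNonNeighbour x≢hub y≢hub hub≁x hub≁y =
    trans (non-neighbour-of-hub x≢hub hub≁x) (sym (non-neighbour-of-hub y≢hub hub≁y))

  atMostOneNonNeighbour⇒hub : ∀ {v} → 2 ≤ n → AtMostOneNonNeighbour G v → v ≡ hub
  atMostOneNonNeighbour⇒hub {hub}  _ _ = refl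
  atMostOneNonNeighbour⇒hub {hub′} (s≤s (s≤s _)) unique
    with () ← unique {hub} {leaf′ zero zero} (λ ()) (λ ()) (λ ()) (λ ())
  atMostOneNonNeighbour⇒hub {leaf′ i a} _ unique
    with () ← unique {hub′} {leaf i a} (λ ()) (λ ()) (λ ()) (λ (_ , a≢a) → a≢a refl)
  -- A leaf has its own copy and the leaves of another triangle as non-neighbours: here n ≥ 2 is used.
  atMostOneNonNeighbour⇒hub {leaf i a} 2≤n unique
    with j , j≢i ← another 2≤n i
    with () ← unique {leaf′ i a} {leaf j a} (λ ()) (j≢i ∘ proj₁ ∘ leaf-injective)
                     (λ (_ , a≢a) → a≢a refl) (λ (i≡j , _) → j≢i (sym i≡j))

  neighbour-of-hub′ : ∀ {x} → Adj G hub′ x → ∃₂ λ j b → x ≡ leaf j b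
  neighbour-of-hub′ {leaf j b} _ = j , b , refl

  neighbour-of-leaf : ∀ {j b x} → Adj G (leaf j b) x →
                      x ≢ hub → x ≢ hub′ → ¬ Adj G hub′ x → x ≡ leaf′ j (opposite b)
  neighbour-of-leaf {x = hub}        _ x≢hub _ _ = contradiction refl x≢hub
  neighbour-of-leaf {x = hub′}       _ _ x≢hub′ _ = contradiction refl x≢hub′
  neighbour-of-leaf {x = leaf _ _}   _ _ _ hub′≁x = contradiction tt hub′≁x
  neighbour-of-leaf {x = leaf′ _ _}  (refl , b≢c) _ _ _ = cong (leaf′ _) (≢⇒opposite b≢c)

module _ {n r} (ℓ : V (F⋆K₁ n) → Fin r) where

  blockAut-preserves : (π : Permutation′ n) (τ : Fin n → Fin 2) →
                       (∀ k x → sideLabel ℓ (π ⟨$⟩ʳ k) (x ⊕ τ k) ≡ sideLabel ℓ k x) →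
                       ∀ v → ℓ (apply (coronaAut (blockAut π τ)) v) ≡ ℓ v
  blockAut-preserves π τ sides hub         = refl
  blockAut-preserves π τ sides hub′        = refl
  blockAut-preserves π τ sides (leaf k x)  = cong proj₁ (sides k x)
  blockAut-preserves π τ sides (leaf′ k x) = cong proj₂ (sides k x)

  -- Also covers i ≡ j, where t = suc zero flips triangle i in place.
  module Swap (i j : Fin n) (t : Fin 2) where

    twist : Fin n → Fin 2
    twist k = if does (k ≟ i) ∨ does (k ≟ j) then t else zero

    swapAut : Aut (F⋆K₁ n)
    swapAut = coronaAut (blockAut (transpose i j) twist)

    swap-sides : (∀ x → sideLabel ℓ i x ≡ sideLabel ℓ j (x ⊕ t)) →
                 ∀ k x → sideLabel ℓ (transpose i j ⟨$⟩ʳ k) (x ⊕ twist k) ≡ sideLabel ℓ k x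
    swap-sides i∼j k x with k ≟ i
    ... | yes refl = sym (i∼j x)
    ... | no _ with k ≟ j
    ...   | yes refl = trans (i∼j (x ⊕ t)) (cong (sideLabel ℓ k) (⊕-involutive x t))
    ...   | no _     = refl

    swap-leaf : ∀ a → apply swapAut (leaf i a) ≡ leaf j (a ⊕ t)
    swap-leaf a with i ≟ i
    ... | yes _  = refl
    ... | no i≢i = contradiction refl i≢i

  distinguishing⇒separated : IsDistinguishingLabeling (F⋆K₁ n) r ℓ → Separated (sideLabel ℓ)
  distinguishing⇒separated dist i a j b e e′ = leaf-injective (begin
    leaf i a                   ≡⟨ dist swapAut swap-preserves (leaf i a) ⟨
    apply swapAut (leaf i a)   ≡⟨ swap-leaf a ⟩
    leaf j (a ⊕ (a ⊕ b))       ≡⟨ cong (leaf j) (⊕-cancelˡ a b) ⟩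
    leaf j b                   ∎)
    where
    open Swap i j (a ⊕ b)
    open ≡-Reasoning
    swap-preserves : ∀ v → ℓ (apply swapAut v) ≡ ℓ v
    swap-preserves = blockAut-preserves _ twist
      (swap-sides (agree⇒⊕-shift {p = sideLabel ℓ i} {q = sideLabel ℓ j} e e′))

module Rigidity {n} (2≤n : 2 ≤ n) (σ : Aut (F⋆K₁ n)) where

  private
    G : Graph
    G = F⋆K₁ n

  σ-hub : apply σ hub ≡ hub
  σ-hub = atMostOneNonNeighbour⇒hub 2≤n (atMostOneNonNeighbour-apply σ hub-atMostOneNonNeighbour)

  σ-hub′ : apply σ hub′ ≡ hub′
  σ-hub′ = non-neighbour-of-hub (apply-≢-at σ σ-hub λ ()) (apply-nonadj-at σ σ-hub λ ())

  σ-leaf : ∀ i a → ∃₂ λ j b → apply σ (leaf i a) ≡ leaf j b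
  σ-leaf i a = neighbour-of-hub′ (apply-adj-at σ σ-hub′ tt)

  σ-leaf-pair : ∀ i a → ∃₂ λ j b → apply σ (leaf i a) ≡ leaf j b
                                 × apply σ (leaf i (opposite a)) ≡ leaf j (opposite b)
  σ-leaf-pair i a with j , b , e ← σ-leaf i a | j′ , b′ , e′ ← σ-leaf i (opposite a)
    with refl , b≢b′ ← subst (Adj G (leaf j b)) e′ (apply-adj-at σ e (refl , opposite-≢ a))
    = j , b , e , trans e′ (cong (leaf j) (≢⇒opposite b≢b′))

  σ-leaf′ : ∀ {i a j b} → apply σ (leaf i a) ≡ leaf j b →
            apply σ (leaf′ i (opposite a)) ≡ leaf′ j (opposite b)
  σ-leaf′ {i} {a} e = neighbour-of-leaf (apply-adj-at σ e (refl , opposite-≢ a))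
    (apply-≢-at σ σ-hub λ ()) (apply-≢-at σ σ-hub′ λ ()) (apply-nonadj-at σ σ-hub′ λ ())

  MapsSide : Fin n → Fin 2 → Fin n → Fin 2 → Set
  MapsSide i a j b = apply σ (leaf i a) ≡ leaf j b × apply σ (leaf′ i a) ≡ leaf′ j b

  σ-triangle : ∀ i a → ∃₂ λ j b → MapsSide i a j b × MapsSide i (opposite a) j (opposite b)
  σ-triangle i a with j , b , e , e′ ← σ-leaf-pair i a =
    j , b , (e , subst₂ (λ a b → apply σ (leaf′ i a) ≡ leaf′ j b)
                        (opposite-involutive a) (opposite-involutive b) (σ-leaf′ e′))
          , (e′ , σ-leaf′ e)

separated⇒distinguishing : ∀ {n r} {ℓ : V (F⋆K₁ n) → Fin r} → 2 ≤ n →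
                           Separated (sideLabel ℓ) → IsDistinguishingLabeling (F⋆K₁ n) r ℓ
separated⇒distinguishing {n} {r} {ℓ} 2≤n sep σ pres = fixes
  where
  open Rigidity 2≤n σ

  transport : ∀ {i a j b} → MapsSide i a j b → sideLabel ℓ j b ≡ sideLabel ℓ i a
  transport {i} {a} (e , e′) =
    cong₂ _,_ (trans (cong ℓ (sym e)) (pres (leaf i a))) (trans (cong ℓ (sym e′)) (pres (leaf′ i a)))

  fixes-side : ∀ i a → MapsSide i a i a
  fixes-side i a with j , b , m , m′ ← σ-triangle i a
    with refl , refl ← sep j b i a (transport m) (transport m′) = m

  fixes : ∀ v → apply σ v ≡ v
  fixes hub         = σ-hub
  fixes hub′        = σ-hub′
  fixes (leaf i a)  = proj₁ (fixes-side i a)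
  fixes (leaf′ i a) = proj₂ (fixes-side i a)

module _ {n : ℕ} where

  distinguishing⇒≤C2 : ∀ {r} → HasDistinguishingLabeling (F⋆K₁ n) r → n ≤ (r * r) C 2
  distinguishing⇒≤C2 {r} (ℓ , dist) = separated⇒≤C2
    (separated-∘ combine-injective (distinguishing⇒separated ℓ dist))
    where
    combine-injective : Injective _≡_ _≡_ (Inverse.to (↔-sym (*↔× {r} {r})))
    combine-injective = Injection.injective (↔⇒↣ (↔-sym *↔×))

  ≤C2⇒distinguishing : ∀ {k} → 2 ≤ n → n ≤ (k * k) C 2 →
                       HasDistinguishingLabeling (F⋆K₁ n) k
  ≤C2⇒distinguishing {k} 2≤n n≤[k*k]C2 with p , separated ← ≤C2⇒separated n≤[k*k]C2 =
    ℓ , separated⇒distinguishing {ℓ = ℓ} 2≤n (separated-∘ remQuot-injective separated)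
    where
    remQuot-injective : Injective _≡_ _≡_ (Inverse.to (*↔× {k} {k}))
    remQuot-injective = Injection.injective (↔⇒↣ *↔×)
    ℓ : V (F⋆K₁ n) → Fin k
    ℓ = sideLabelling (proj₁ (Inverse.to *↔× (p (fromℕ< 2≤n) zero)))
                      (λ i a → Inverse.to *↔× (p i a))

ceilNestedSqrt-exists : ∀ {n} → 2 ≤ n → ∃ (IsCeilNestedSqrt n)
ceilNestedSqrt-exists {n} 2≤n =
  least-witness (ceilBound? n) {n}
    (Equivalence.from (ceilBound⇔ n (<⇒≤ 2≤n)) (n≤[n*n]C2 2≤n))

ceilNestedSqrt-distinguishingNumber : ∀ {n k} → 2 ≤ n → IsCeilNestedSqrt n k →
                                      DistinguishingNumberIs (F⋆K₁ n) k
ceilNestedSqrt-distinguishingNumber {n} {k} 2≤n (bound , minimal) =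
  ≤C2⇒distinguishing 2≤n (Equivalence.to (ceilBound⇔ k 1≤n) bound) ,
  λ r r<k labelling →
    minimal r r<k (Equivalence.from (ceilBound⇔ r 1≤n) (distinguishing⇒≤C2 labelling))
  where
  1≤n : 1 ≤ n
  1≤n = <⇒≤ 2≤n

theorem3p3 : (n : ℕ) → 2 ≤ n →
    ∃ λ k → IsCeilNestedSqrt n k × DistinguishingNumberIs (Friendship n ⋆K₁) k
theorem3p3 n 2≤n with k , isCeil ← ceilNestedSqrt-exists 2≤n =
  k , isCeil , ceilNestedSqrt-distinguishingNumber 2≤n isCeil
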